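{- There exists $n_0$ such that the following holds. Let $H$ be a connected graph with at least $n_0$ vertices that contains no subgraph isomorphic to $S_{4,4}$, let $y_0$ be a vertex of $H$ with $\deg y_0\ge 4$, and let $y_0y_1y_2y_3y_4$ be a path in $H$ (distinct vertices with $y_i\sim y_{i+1}$). Then: 1. $\deg y_0=4$; 2. $y_0\sim y_2$, $y_0\not\sim y_3$, and $y_0\not\sim y_4$; 3. if $N(y_0)=\{y_1,y_2,y',y''\}$, then $y_1\not\sim y'$ and $y_1\not\sim y''$.
   Context: Graphs are finite, simple and undirected; $\sim$ denotes adjacency, $N(v)$ the set of neighbours of $v$, and $\deg v=|N(v)|$. Subgraphs are not necessarily induced. The sparkler graph $S_{4,4}$ is obtained from the star $K_{1,3}$ and the path $P_4$ on 4 vertices by adding an edge between an end vertex of $P_4$ and the central vertex of $K_{1,3}$. -}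

module Defs where

open import Data.Nat using (ℕ; zero; suc)
open import Data.Fin using (Fin; #_)
open import Data.Bool using (Bool; true; false; T)
open import Data.List using (List; []; _∷_; length; filter; allFin)
open import Data.Product using (Σ; _×_; _,_; ∃)
open import Relation.Binary.PropositionalEquality using (_≡_; _≢_)
open import Relation.Nullary using (¬_)
open import Function.Definitions using (Injective)
open import Data.Bool.Properties using (T?)

record Graph (n : ℕ) : Set where
  field
    adj   : Fin n → Fin n → Bool
    sym   : ∀ u v → adj u v ≡ adj v u
    irrefl : ∀ v → adj v v ≡ false

open Graph public

_∼[_]_ : {n : ℕ} → Fin n → Graph n → Fin n → Set
u ∼[ G ] v = T (adj G u v)

nbrs : {n : ℕ} → Graph n → Fin n → List (Fin n)
nbrs G v = filter (λ u → T? (adj G v u)) (allFin _)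

deg : {n : ℕ} → Graph n → Fin n → ℕ
deg G v = length (nbrs G v)

data Walk {n : ℕ} (G : Graph n) : Fin n → Fin n → Set where
  [] : ∀ {u} → Walk G u u
  _∷_ : ∀ {u w v} → u ∼[ G ] w → Walk G w v → Walk G u v

Connected : {n : ℕ} → Graph n → Set
Connected G = ∀ u v → Walk G u v

-- The sparkler S_{4,4} on vertex set Fin 8:
--   0 = centre c of K_{1,3}, 1,2,3 = its leaves,
--   4,5,6,7 = the path P_4 (4-5-6-7), plus the edge 0-4.
-- H contains a (not necessarily induced) subgraph isomorphic to S_{4,4}
-- iff there is an injective vertex map preserving these 7 edges.
record S44-in {n : ℕ} (G : Graph n) : Set where
  field
    f     : Fin 8 → Fin n
    inj   : Injective _≡_ _≡_ f
    e01   : f (# 0) ∼[ G ] f (# 1)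
    e02   : f (# 0) ∼[ G ] f (# 2)
    e03   : f (# 0) ∼[ G ] f (# 3)
    e04   : f (# 0) ∼[ G ] f (# 4)
    e45   : f (# 4) ∼[ G ] f (# 5)
    e56   : f (# 5) ∼[ G ] f (# 6)
    e67   : f (# 6) ∼[ G ] f (# 7)

S44-free : {n : ℕ} → Graph n → Set
S44-free G = ¬ S44-in G

module Submission where

-- Key construction (GraphFacts): a path c a b d e plus
-- three further neighbours of c is a copy of S₄,₄; the extra neighbours exist
-- when deg c ≥ 7 (big-tail), when deg c ≥ 4 and c ≁ b, d, e (hub-tail), and
-- when deg c ≥ 5 and c ≁ d, e (roomy-tail).
--
-- Radius: a vertex at distance 4 from y₀ would end a shortest path from y₀,
-- a hub tail; so all vertices lie within distance 3 of y₀, and if none within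
-- distance 2 had degree ≥ 7 then n ≤ 7³ = 343.  AroundPath: for n ≥ 344 such
-- a big vertex v exists; every position of v other than y₂ yields a big tail
-- at v, and the possible big tails at y₂ force y₀ ∼ y₂, y₀ ≁ y₃, y₀ ≁ y₄ and
-- make y₂ the only common neighbour of y₀ and y₁.  A fifth neighbour of y₀
-- would give a roomy tail y₀y₁y₂y₃y₄, so deg y₀ = 4, and the last claim
-- follows because N(y₀) has only four elements.

open import Defs
open import Data.Nat using (ℕ; _≥_; zero; suc; _≤_; _<_; _+_; _*_; z≤n)
open import Data.Nat.Properties
  using (≤-refl; <⇒≤; <⇒≱; ≰⇒>; +-mono-≤; *-suc; *-monoˡ-≤; ≤∧≢⇒<; module ≤-Reasoning)
  renaming (_≤?_ to _≤ℕ?_; _≟_ to _≟ℕ_)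
open import Data.Fin using (Fin; zero; suc; _≟_)
open import Data.Fin.Properties using (injective⇒≤)
open import Data.List using (List; []; _∷_; length; lookup; _++_; concatMap; allFin)
open import Data.List.Properties using (length-++)
open import Data.List.Relation.Unary.Any using (here; there; index)
open import Data.List.Relation.Unary.All as All using (All; []; _∷_; all?)
open import Data.List.Relation.Unary.All.Properties.Core using (¬Any⇒All¬; ¬All⇒Any¬)
open import Data.List.Relation.Unary.AllPairs using ([]; _∷_)
open import Data.List.Relation.Unary.Unique.Propositional using (Unique)
import Data.List.Relation.Unary.Unique.Propositional.Properties as Unique
open import Data.List.Membership.Propositional using (_∈_; _∉_; find; lose)
open import Data.List.Membership.Propositional.Properties
  using (∈-lookup; ∈-++⁺ˡ; ∈-++⁺ʳ; ∈-++⁻; ∈-concatMap⁺; ∈-concatMap⁻; ∈-filter⁺; ∈-filter⁻; ∈-allFin)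
import Data.List.Membership.Setoid.Properties as SetoidMembership
open import Data.Product using (Σ; ∃; ∃₂; _×_; _,_; proj₂)
open import Data.Sum using (_⊎_; inj₁; inj₂; map₂; swap)
open import Data.Bool using (T)
open import Data.Empty using (⊥; ⊥-elim)
open import Relation.Nullary using (¬_; yes; no; contradiction)
open import Relation.Nullary.Decidable.Core using (T?)
open import Relation.Binary.PropositionalEquality
  using (_≡_; _≢_; refl; cong; subst; setoid; ≢-sym)
open import Function.Definitions using (Injective)
open import Function.Bundles using (_⇔_; Equivalence)

module _ {A : Set} where

  lookup-injective : {xs : List A} → Unique xs → Injective _≡_ _≡_ (lookup xs)
  lookup-injective (_ ∷ _)    {zero}  {zero}  _     = refl
  lookup-injective (x∉xs ∷ _) {zero}  {suc j} x≡xⱼ = ⊥-elim (All.lookup x∉xs (∈-lookup j) x≡xⱼ)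
  lookup-injective (x∉xs ∷ _) {suc i} {zero}  xᵢ≡x = ⊥-elim (≢-sym (All.lookup x∉xs (∈-lookup i)) xᵢ≡x)
  lookup-injective (_ ∷ uniq) {suc i} {suc j} xᵢ≡xⱼ = cong suc (lookup-injective uniq xᵢ≡xⱼ)

  -- A duplicate-free list is no longer than any list containing all its
  -- entries: sending a position to the position of its entry is injective.
  length-mono : {xs ys : List A} → Unique xs → (∀ {x} → x ∈ xs → x ∈ ys) → length xs ≤ length ys
  length-mono {xs} {ys} uniq xs⊆ys = injective⇒≤ {f = position} position-injective
    where
    position : Fin (length xs) → Fin (length ys)
    position i = index (xs⊆ys (∈-lookup i))
    position-injective : Injective _≡_ _≡_ position
    position-injective same = lookup-injective uniq
      (SetoidMembership.index-injective (setoid A) (xs⊆ys (∈-lookup _)) (xs⊆ys (∈-lookup _)) same)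

  ∈∉⇒≢ : ∀ {u v} {xs : List A} → u ∈ xs → v ∉ xs → u ≢ v
  ∈∉⇒≢ u∈xs v∉xs refl = v∉xs u∈xs

module GraphFacts {n : ℕ} (H : Graph n) where

  open import Data.List.Membership.DecPropositional (_≟_ {n}) using (_∈?_)

  _∼_ : Fin n → Fin n → Set
  u ∼ v = u ∼[ H ] v

  ∼-sym : ∀ {u v} → u ∼ v → v ∼ u
  ∼-sym {u} {v} = subst T (Graph.sym H u v)

  ∼⇒≢ : ∀ {u v} → u ∼ v → u ≢ v
  ∼⇒≢ {u} u∼u refl = subst T (Graph.irrefl H u) u∼u

  ≁⇒≢ : ∀ {c u v} → c ∼ u → ¬ c ∼ v → u ≢ v
  ≁⇒≢ c∼u c≁u refl = c≁u c∼u

  ∈-nbrs⁺ : ∀ {c v} → c ∼ v → v ∈ nbrs H c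
  ∈-nbrs⁺ {c} {v} = ∈-filter⁺ (λ u → T? (adj H c u)) (∈-allFin v)

  ∈-nbrs⁻ : ∀ {c v} → v ∈ nbrs H c → c ∼ v
  ∈-nbrs⁻ {c} v∈N = proj₂ (∈-filter⁻ (λ u → T? (adj H c u)) {xs = allFin n} v∈N)

  -- A vertex with more neighbours than xs has entries has a neighbour
  -- outside xs (the neighbour list has no repetitions).
  fresh-neighbour : ∀ c (xs : List (Fin n)) → length xs < deg H c → ∃ λ z → c ∼ z × All (z ≢_) xs
  fresh-neighbour c xs short with all? (_∈? xs) (nbrs H c)
  ... | yes N⊆xs = contradiction (length-mono N-unique (All.lookup N⊆xs)) (<⇒≱ short)
    where
    N-unique : Unique (nbrs H c)
    N-unique = Unique.filter⁺ (λ u → T? (adj H c u)) (Unique.allFin⁺ n)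
  ... | no N⊈xs with z , z∈N , z∉xs ← find (¬All⇒Any¬ (_∈? xs) (nbrs H c) N⊈xs) =
    z , ∈-nbrs⁻ z∈N , ¬Any⇒All¬ xs z∉xs

  -- c a b d e is a path on five distinct vertices; distinctness of
  -- consecutive vertices already follows from the edges.
  record Path₅ (c a b d e : Fin n) : Set where
    constructor path
    field
      c∼a : c ∼ a
      a∼b : a ∼ b
      b∼d : b ∼ d
      d∼e : d ∼ e
      c≢b : c ≢ b
      c≢d : c ≢ d
      c≢e : c ≢ e
      a≢d : a ≢ d
      a≢e : a ≢ e
      b≢e : b ≢ e

  reverse : ∀ {c a b d e} → Path₅ c a b d e → Path₅ e d b a c
  reverse (path c∼a a∼b b∼d d∼e c≢b c≢d c≢e a≢d a≢e b≢e) =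
    path (∼-sym d∼e) (∼-sym b∼d) (∼-sym a∼b) (∼-sym c∼a)
         (≢-sym b≢e) (≢-sym a≢e) (≢-sym c≢e) (≢-sym a≢d) (≢-sym c≢d) (≢-sym c≢b)

  sparkler : ∀ {c a b d e z₁ z₂ z₃} → Path₅ c a b d e → c ∼ z₁ → c ∼ z₂ → c ∼ z₃ →
             Unique (c ∷ z₁ ∷ z₂ ∷ z₃ ∷ a ∷ b ∷ d ∷ e ∷ []) → S44-in H
  sparkler {c} {a} {b} {d} {e} {z₁} {z₂} {z₃} P c∼z₁ c∼z₂ c∼z₃ distinct = record
    { f = lookup (c ∷ z₁ ∷ z₂ ∷ z₃ ∷ a ∷ b ∷ d ∷ e ∷ [])
    ; inj = lookup-injective distinct
    ; e01 = c∼z₁ ; e02 = c∼z₂ ; e03 = c∼z₃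
    ; e04 = c∼a ; e45 = a∼b ; e56 = b∼d ; e67 = d∼e }
    where open Path₅ P

  sparkler-with-room : ∀ {c a b d e} → Path₅ c a b d e → (xs : List (Fin n)) →
    3 + length xs ≤ deg H c →
    (∀ {z} → c ∼ z → All (z ≢_) xs → All (z ≢_) (a ∷ b ∷ d ∷ e ∷ [])) → S44-in H
  sparkler-with-room {c} P xs room avoids-tail
    with z₁ , c∼z₁ , z₁∉xs ← fresh-neighbour c xs (<⇒≤ (<⇒≤ room))
    with z₂ , c∼z₂ , z₂≢z₁ ∷ z₂∉xs ← fresh-neighbour c (_ ∷ xs) (<⇒≤ room)
    with z₃ , c∼z₃ , z₃≢z₂ ∷ z₃≢z₁ ∷ z₃∉xs ← fresh-neighbour c (_ ∷ _ ∷ xs) room =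
    sparkler P c∼z₁ c∼z₂ c∼z₃
      ( (∼⇒≢ c∼z₁ ∷ ∼⇒≢ c∼z₂ ∷ ∼⇒≢ c∼z₃ ∷ ∼⇒≢ c∼a ∷ c≢b ∷ c≢d ∷ c≢e ∷ [])
      ∷ (≢-sym z₂≢z₁ ∷ ≢-sym z₃≢z₁ ∷ avoids-tail c∼z₁ z₁∉xs)
      ∷ (≢-sym z₃≢z₂ ∷ avoids-tail c∼z₂ z₂∉xs)
      ∷ avoids-tail c∼z₃ z₃∉xs
      ∷ (∼⇒≢ a∼b ∷ a≢d ∷ a≢e ∷ [])
      ∷ (∼⇒≢ b∼d ∷ b≢e ∷ [])
      ∷ (∼⇒≢ d∼e ∷ [])
      ∷ []
      ∷ [])
    where open Path₅ P

  big-tail : ∀ {c a b d e} → Path₅ c a b d e → 7 ≤ deg H c → S44-in H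
  big-tail {a = a} {b} {d} {e} P big = sparkler-with-room P (a ∷ b ∷ d ∷ e ∷ []) big (λ _ z∉tail → z∉tail)

  hub-tail : ∀ {c a b d e} → Path₅ c a b d e → 4 ≤ deg H c →
             ¬ c ∼ b → ¬ c ∼ d → ¬ c ∼ e → S44-in H
  hub-tail {a = a} P hub c≁b c≁d c≁e = sparkler-with-room P (a ∷ []) hub
    λ c∼z → λ { (z≢a ∷ []) → z≢a ∷ ≁⇒≢ c∼z c≁b ∷ ≁⇒≢ c∼z c≁d ∷ ≁⇒≢ c∼z c≁e ∷ [] }

  roomy-tail : ∀ {c a b d e} → Path₅ c a b d e → 5 ≤ deg H c →
               ¬ c ∼ d → ¬ c ∼ e → S44-in H
  roomy-tail {a = a} {b} P room c≁d c≁e = sparkler-with-room P (a ∷ b ∷ []) room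
    λ c∼z → λ { (z≢a ∷ z≢b ∷ []) → z≢a ∷ z≢b ∷ ≁⇒≢ c∼z c≁d ∷ ≁⇒≢ c∼z c≁e ∷ [] }

  -- ball x r lists (with repetitions) the vertices at distance ≤ r from x.
  ball : Fin n → ℕ → List (Fin n)
  ball x zero    = x ∷ []
  ball x (suc r) = ball x r ++ concatMap (nbrs H) (ball x r)

  ball-mono : ∀ {x} r {v} → v ∈ ball x r → v ∈ ball x (suc r)
  ball-mono _ = ∈-++⁺ˡ

  centre∈ball : ∀ x r → x ∈ ball x r
  centre∈ball x zero    = here refl
  centre∈ball x (suc r) = ball-mono r (centre∈ball x r)

  ball-step : ∀ {x} r {u v} → u ∈ ball x r → u ∼ v → v ∈ ball x (suc r)
  ball-step {x} r u∈B u∼v = ∈-++⁺ʳ (ball x r) (∈-concatMap⁺ (nbrs H) (lose u∈B (∈-nbrs⁺ u∼v)))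

  ball-pred : ∀ {x} r {v} → v ∈ ball x (suc r) → v ∈ ball x r ⊎ ∃ λ u → u ∈ ball x r × u ∼ v
  ball-pred {x} r v∈B with ∈-++⁻ (ball x r) v∈B
  ... | inj₁ v∈B′ = inj₁ v∈B′
  ... | inj₂ v∈N with u , u∈B , v∈Nu ← find (∈-concatMap⁻ (nbrs H) {xs = ball x r} v∈N) =
    inj₂ (u , u∈B , ∈-nbrs⁻ v∈Nu)

  ball₁ : ∀ {x v} → v ∈ ball x 1 → v ≡ x ⊎ x ∼ v
  ball₁ v∈B with ball-pred 0 v∈B
  ... | inj₁ (here v≡x)            = inj₁ v≡x
  ... | inj₂ (_ , here refl , x∼v) = inj₂ x∼v

  ball₂ : ∀ {x v} → v ∈ ball x 2 → v ≡ x ⊎ x ∼ v ⊎ ∃ λ p → x ∼ p × p ∼ v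
  ball₂ v∈B with ball-pred 1 v∈B
  ... | inj₁ v∈B₁ = map₂ inj₁ (ball₁ v∈B₁)
  ... | inj₂ (p , p∈B₁ , p∼v) with ball₁ p∈B₁
  ...   | inj₁ refl = inj₂ (inj₁ p∼v)
  ...   | inj₂ x∼p  = inj₂ (inj₂ (p , x∼p , p∼v))

  -- Each vertex contributes at most Δ new entries to the next ball.
  ball-growth : ∀ {x} r Δ → (∀ {v} → v ∈ ball x r → deg H v ≤ Δ) →
                length (ball x (suc r)) ≤ length (ball x r) * suc Δ
  ball-growth {x} r Δ bounded
    rewrite length-++ (ball x r) {concatMap (nbrs H) (ball x r)} | *-suc (length (ball x r)) Δ =
    +-mono-≤ ≤-refl (neighbours (ball x r) bounded)
    where
    neighbours : ∀ vs → (∀ {v} → v ∈ vs → deg H v ≤ Δ) → length (concatMap (nbrs H) vs) ≤ length vs * Δ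
    neighbours []       _       = z≤n
    neighbours (v ∷ vs) bounded′ rewrite length-++ (nbrs H v) {concatMap (nbrs H) vs} =
      +-mono-≤ (bounded′ (here refl)) (neighbours vs (λ v∈vs → bounded′ (there v∈vs)))

  closed-covers : Connected H → ∀ {x} (xs : List (Fin n)) → x ∈ xs →
                  (∀ {u v} → u ∈ xs → u ∼ v → v ∈ xs) → ∀ v → v ∈ xs
  closed-covers conn {x} xs x∈xs closed v = along (conn x v) x∈xs
    where
    along : ∀ {u w} → Walk H u w → u ∈ xs → w ∈ xs
    along []          u∈xs = u∈xs
    along (u∼u′ ∷ wk) u∈xs = along wk (closed u∈xs u∼u′)

  covering-length : (xs : List (Fin n)) → (∀ v → v ∈ xs) → n ≤ length xs
  covering-length xs cover = injective⇒≤ {f = position} λ {u} {v} →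
    SetoidMembership.index-injective (setoid (Fin n)) (cover u) (cover v)
    where
    position : Fin n → Fin (length xs)
    position v = index (cover v)

module Radius {n : ℕ} (H : Graph n) (free : S44-free H) (x : Fin n) (deg≥4 : deg H x ≥ 4) where

  open GraphFacts H
  open import Data.List.Membership.DecPropositional (_≟_ {n}) using (_∈?_)

  nbr∈ball₁ : ∀ {u} → x ∼ u → u ∈ ball x 1
  nbr∈ball₁ = ball-step 0 (centre∈ball x 0)

  far-path : ∀ {v w} → v ∈ ball x 3 → v ∼ w → w ∉ ball x 3 →
             ∃₂ λ b c → Path₅ x b c v w × ¬ x ∼ c × ¬ x ∼ v × ¬ x ∼ w
  far-path {v} {w} v∈B₃ v∼w w∉B₃ = from-v (ball-pred 2 v∈B₃)
    where
    v∉B₂ : v ∉ ball x 2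
    v∉B₂ v∈B₂ = w∉B₃ (ball-step 2 v∈B₂ v∼w)

    from-v : v ∈ ball x 2 ⊎ (∃ λ c → c ∈ ball x 2 × c ∼ v) →
             ∃₂ λ b c → Path₅ x b c v w × ¬ x ∼ c × ¬ x ∼ v × ¬ x ∼ w
    from-v (inj₁ v∈B₂)               = contradiction v∈B₂ v∉B₂
    from-v (inj₂ (c , c∈B₂ , c∼v)) = from-c (ball-pred 1 c∈B₂)
      where
      c∉B₁ : c ∉ ball x 1
      c∉B₁ c∈B₁ = v∉B₂ (ball-step 1 c∈B₁ c∼v)

      from-c : c ∈ ball x 1 ⊎ (∃ λ b → b ∈ ball x 1 × b ∼ c) →
               ∃₂ λ b c → Path₅ x b c v w × ¬ x ∼ c × ¬ x ∼ v × ¬ x ∼ w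
      from-c (inj₁ c∈B₁)               = contradiction c∈B₁ c∉B₁
      from-c (inj₂ (b , b∈B₁ , b∼c)) with ball₁ b∈B₁
      ... | inj₁ refl = contradiction (nbr∈ball₁ b∼c) c∉B₁
      ... | inj₂ x∼b  =
        b , c ,
        path x∼b b∼c c∼v v∼w
          (∈∉⇒≢ (centre∈ball x 1) c∉B₁) (∈∉⇒≢ (centre∈ball x 2) v∉B₂) (∈∉⇒≢ (centre∈ball x 3) w∉B₃)
          (∈∉⇒≢ (ball-mono 1 b∈B₁) v∉B₂) (∈∉⇒≢ (ball-mono 2 (ball-mono 1 b∈B₁)) w∉B₃) (∈∉⇒≢ (ball-mono 2 c∈B₂) w∉B₃) ,
        (λ x∼c → c∉B₁ (nbr∈ball₁ x∼c)) ,
        (λ x∼v → v∉B₂ (ball-mono 1 (nbr∈ball₁ x∼v))) ,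
        (λ x∼w → w∉B₃ (ball-mono 2 (ball-mono 1 (nbr∈ball₁ x∼w))))

  ball₃-closed : ∀ {v w} → v ∈ ball x 3 → v ∼ w → w ∈ ball x 3
  ball₃-closed {v} {w} v∈B₃ v∼w with w ∈? ball x 3
  ... | yes w∈B₃ = w∈B₃
  ... | no w∉B₃ with _ , _ , P , x≁c , x≁v , x≁w ← far-path v∈B₃ v∼w w∉B₃ =
    ⊥-elim (free (hub-tail P deg≥4 x≁c x≁v x≁w))

  small-without-big : Connected H → (∀ {v} → v ∈ ball x 2 → deg H v ≤ 6) → n ≤ 343
  small-without-big conn bounded = begin
    n                          ≤⟨ covering-length (ball x 3) everything-near ⟩
    length (ball x 3)          ≤⟨ ball-growth 2 6 bounded ⟩
    length (ball x 2) * 7      ≤⟨ *-monoˡ-≤ 7 (ball-growth 1 6 (λ v∈B₁ → bounded (ball-mono 1 v∈B₁))) ⟩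
    length (ball x 1) * 7 * 7  ≤⟨ *-monoˡ-≤ 7 (*-monoˡ-≤ 7
                                    (ball-growth 0 6 (λ v∈B₀ → bounded (ball-mono 1 (ball-mono 0 v∈B₀))))) ⟩
    1 * 7 * 7 * 7              ∎
    where
    open ≤-Reasoning
    everything-near : ∀ v → v ∈ ball x 3
    everything-near = closed-covers conn (ball x 3) (centre∈ball x 3) ball₃-closed

  big-vertex-near : Connected H → 344 ≤ n → ∃ λ v → v ∈ ball x 2 × 7 ≤ deg H v
  big-vertex-near conn large with all? (λ v → deg H v ≤ℕ? 6) (ball x 2)
  ... | yes bounded = contradiction (small-without-big conn (All.lookup bounded)) (<⇒≱ large)
  ... | no unbounded with v , v∈B₂ , deg≰6 ← find (¬All⇒Any¬ (λ v → deg H v ≤ℕ? 6) (ball x 2) unbounded) =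
    v , v∈B₂ , ≰⇒> deg≰6

module AroundPath {n : ℕ} (H : Graph n) (free : S44-free H) (y₀ y₁ y₂ y₃ y₄ : Fin n)
  (deg≥4 : deg H y₀ ≥ 4)
  (y₀≢y₂ : y₀ ≢ y₂) (y₀≢y₃ : y₀ ≢ y₃) (y₀≢y₄ : y₀ ≢ y₄) (y₁≢y₃ : y₁ ≢ y₃) (y₁≢y₄ : y₁ ≢ y₄) (y₂≢y₄ : y₂ ≢ y₄)
  (y₀∼y₁ : y₀ ∼[ H ] y₁) (y₁∼y₂ : y₁ ∼[ H ] y₂) (y₂∼y₃ : y₂ ∼[ H ] y₃) (y₃∼y₄ : y₃ ∼[ H ] y₄) where

  open GraphFacts H
  open Radius H free y₀ deg≥4 using (big-vertex-near)

  P : Path₅ y₀ y₁ y₂ y₃ y₄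
  P = path y₀∼y₁ y₁∼y₂ y₂∼y₃ y₃∼y₄ y₀≢y₂ y₀≢y₃ y₀≢y₄ y₁≢y₃ y₁≢y₄ y₂≢y₄

  y₀≢y₁ : y₀ ≢ y₁
  y₀≢y₁ = ∼⇒≢ y₀∼y₁

  y₁≢y₂ : y₁ ≢ y₂
  y₁≢y₂ = ∼⇒≢ y₁∼y₂

  y₂≢y₃ : y₂ ≢ y₃
  y₂≢y₃ = ∼⇒≢ y₂∼y₃

  no-big-tail : ∀ {c a b d e} → Path₅ c a b d e → 7 ≤ deg H c → ⊥
  no-big-tail T big = free (big-tail T big)

  -- Otherwise y₀ y₁ y₂ y₃ y₄ would be a hub tail.
  y₀-sees-path : y₀ ∼ y₂ ⊎ y₀ ∼ y₃ ⊎ y₀ ∼ y₄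
  y₀-sees-path with T? (adj H y₀ y₂) | T? (adj H y₀ y₃) | T? (adj H y₀ y₄)
  ... | yes y₀∼y₂ | _          | _          = inj₁ y₀∼y₂
  ... | no _      | yes y₀∼y₃ | _          = inj₂ (inj₁ y₀∼y₃)
  ... | no _      | no _       | yes y₀∼y₄ = inj₂ (inj₂ y₀∼y₄)
  ... | no y₀≁y₂  | no y₀≁y₃  | no y₀≁y₄  = ⊥-elim (free (hub-tail P deg≥4 y₀≁y₂ y₀≁y₃ y₀≁y₄))

  other-neighbour : ∀ u → ∃ λ z → y₀ ∼ z × All (z ≢_) (y₁ ∷ y₂ ∷ u ∷ [])
  other-neighbour u = fresh-neighbour y₀ (y₁ ∷ y₂ ∷ u ∷ []) deg≥4

  -- y₁ starts a path on five vertices whichever of y₂, y₃, y₄ is adjacent to y₀.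
  y₁-not-big : 7 ≤ deg H y₁ → ⊥
  y₁-not-big big with y₀-sees-path
  ... | inj₁ y₀∼y₂ =
    no-big-tail (path (∼-sym y₀∼y₁) y₀∼y₂ y₂∼y₃ y₃∼y₄ y₁≢y₂ y₁≢y₃ y₁≢y₄ y₀≢y₃ y₀≢y₄ y₂≢y₄) big
  ... | inj₂ (inj₁ y₀∼y₃) with z , y₀∼z , z≢y₁ ∷ z≢y₂ ∷ z≢y₃ ∷ [] ← other-neighbour y₃ =
    no-big-tail (path y₁∼y₂ y₂∼y₃ (∼-sym y₀∼y₃) y₀∼z
                  y₁≢y₃ (≢-sym y₀≢y₁) (≢-sym z≢y₁) (≢-sym y₀≢y₂) (≢-sym z≢y₂) (≢-sym z≢y₃)) big
  ... | inj₂ (inj₂ y₀∼y₄) =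
    no-big-tail (path (∼-sym y₀∼y₁) y₀∼y₄ (∼-sym y₃∼y₄) (∼-sym y₂∼y₃)
                  y₁≢y₄ y₁≢y₃ y₁≢y₂ y₀≢y₃ y₀≢y₂ (≢-sym y₂≢y₄)) big

  -- A big neighbour u of y₁ off the path starts u y₁ y₀ and two more path vertices.
  through-y₁ : ∀ {u} → y₁ ∼ u → u ≢ y₀ → u ≢ y₂ → u ≢ y₃ → u ≢ y₄ → 7 ≤ deg H u → ⊥
  through-y₁ y₁∼u u≢y₀ u≢y₂ u≢y₃ u≢y₄ big with y₀-sees-path
  ... | inj₁ y₀∼y₂ =
    no-big-tail (path (∼-sym y₁∼u) (∼-sym y₀∼y₁) y₀∼y₂ y₂∼y₃ u≢y₀ u≢y₂ u≢y₃ y₁≢y₂ y₁≢y₃ y₀≢y₃) big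
  ... | inj₂ (inj₁ y₀∼y₃) =
    no-big-tail (path (∼-sym y₁∼u) (∼-sym y₀∼y₁) y₀∼y₃ y₃∼y₄ u≢y₀ u≢y₃ u≢y₄ y₁≢y₃ y₁≢y₄ y₀≢y₄) big
  ... | inj₂ (inj₂ y₀∼y₄) =
    no-big-tail (path (∼-sym y₁∼u) (∼-sym y₀∼y₁) y₀∼y₄ (∼-sym y₃∼y₄) u≢y₀ u≢y₄ u≢y₃ y₁≢y₄ y₁≢y₃ y₀≢y₃) big

  -- A big neighbour u of y₂ other than y₀, y₁ starts u y₂ y₁ y₀ z.
  through-y₂ : ∀ {u} → y₂ ∼ u → u ≢ y₀ → u ≢ y₁ → 7 ≤ deg H u → ⊥
  through-y₂ {u} y₂∼u u≢y₀ u≢y₁ big with z , y₀∼z , z≢y₁ ∷ z≢y₂ ∷ z≢u ∷ [] ← other-neighbour u =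
    no-big-tail (path (∼-sym y₂∼u) (∼-sym y₁∼y₂) (∼-sym y₀∼y₁) y₀∼z
                  u≢y₁ u≢y₀ (≢-sym z≢u) (≢-sym y₀≢y₂) (≢-sym z≢y₂) (≢-sym z≢y₁)) big

  off-path-not-big : ∀ {v} → v ≡ y₀ ⊎ y₀ ∼ v ⊎ (∃ λ p → y₀ ∼ p × p ∼ v) →
                     v ≢ y₀ → v ≢ y₁ → v ≢ y₂ → v ≢ y₃ → v ≢ y₄ → 7 ≤ deg H v → ⊥
  off-path-not-big (inj₁ v≡y₀) v≢y₀ _ _ _ _ _ = v≢y₀ v≡y₀
  off-path-not-big (inj₂ (inj₁ y₀∼v)) _ v≢y₁ v≢y₂ v≢y₃ _ big =
    no-big-tail (path (∼-sym y₀∼v) y₀∼y₁ y₁∼y₂ y₂∼y₃ v≢y₁ v≢y₂ v≢y₃ y₀≢y₂ y₀≢y₃ y₁≢y₃) big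
  off-path-not-big (inj₂ (inj₂ (p , y₀∼p , p∼v))) v≢y₀ v≢y₁ v≢y₂ v≢y₃ v≢y₄ big with p ≟ y₁ | p ≟ y₂
  ... | yes refl | _        = through-y₁ p∼v v≢y₀ v≢y₂ v≢y₃ v≢y₄ big
  ... | _        | yes refl = through-y₂ p∼v v≢y₀ v≢y₁ big
  ... | no p≢y₁  | no p≢y₂  =
    no-big-tail (path (∼-sym p∼v) (∼-sym y₀∼p) y₀∼y₁ y₁∼y₂ v≢y₀ v≢y₁ v≢y₂ p≢y₁ p≢y₂ y₀≢y₂) big

  big-is-y₂ : ∀ {v} → v ∈ ball y₀ 2 → 7 ≤ deg H v → v ≡ y₂
  big-is-y₂ {v} v∈B₂ big with v ≟ y₀ | v ≟ y₁ | v ≟ y₂ | v ≟ y₃ | v ≟ y₄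
  ... | yes refl | _        | _        | _        | _        = ⊥-elim (no-big-tail P big)
  ... | _        | yes refl | _        | _        | _        = ⊥-elim (y₁-not-big big)
  ... | _        | _        | yes v≡y₂ | _        | _        = v≡y₂
  ... | _        | _        | _        | yes refl | _        =
    ⊥-elim (through-y₂ y₂∼y₃ (≢-sym y₀≢y₃) (≢-sym y₁≢y₃) big)
  ... | _        | _        | _        | _        | yes refl = ⊥-elim (no-big-tail (reverse P) big)
  ... | no v≢y₀  | no v≢y₁  | no v≢y₂  | no v≢y₃  | no v≢y₄  =
    ⊥-elim (off-path-not-big (ball₂ v∈B₂) v≢y₀ v≢y₁ v≢y₂ v≢y₃ v≢y₄ big)

  record Shape : Set where
    field
      y₀∼y₂ : y₀ ∼ y₂
      y₀≁y₃ : ¬ y₀ ∼ y₃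
      y₀≁y₄ : ¬ y₀ ∼ y₄
      only-common-neighbour : ∀ {z} → y₀ ∼ z → y₁ ∼ z → z ≡ y₂

  -- If y₂ is big, each failure of the Shape would be a big tail at y₂.
  big-y₂-shape : 7 ≤ deg H y₂ → Shape
  big-y₂-shape big = record
    { y₀∼y₂ = y₀∼y₂ ; y₀≁y₃ = y₀≁y₃ ; y₀≁y₄ = y₀≁y₄ ; only-common-neighbour = only-common }
    where
    y₀≁y₃ : ¬ y₀ ∼ y₃
    y₀≁y₃ y₀∼y₃ = no-big-tail (path (∼-sym y₁∼y₂) (∼-sym y₀∼y₁) y₀∼y₃ y₃∼y₄
                    (≢-sym y₀≢y₂) y₂≢y₃ y₂≢y₄ y₁≢y₃ y₁≢y₄ y₀≢y₄) big

    y₀≁y₄ : ¬ y₀ ∼ y₄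
    y₀≁y₄ y₀∼y₄ = no-big-tail (path (∼-sym y₁∼y₂) (∼-sym y₀∼y₁) y₀∼y₄ (∼-sym y₃∼y₄)
                    (≢-sym y₀≢y₂) y₂≢y₄ y₂≢y₃ y₁≢y₄ y₁≢y₃ y₀≢y₃) big

    y₀∼y₂ : y₀ ∼ y₂
    y₀∼y₂ with y₀-sees-path
    ... | inj₁ y₀∼y₂        = y₀∼y₂
    ... | inj₂ (inj₁ y₀∼y₃) = contradiction y₀∼y₃ y₀≁y₃
    ... | inj₂ (inj₂ y₀∼y₄) = contradiction y₀∼y₄ y₀≁y₄

    only-common : ∀ {z} → y₀ ∼ z → y₁ ∼ z → z ≡ y₂
    only-common {z} y₀∼z y₁∼z with z ≟ y₂
    ... | yes z≡y₂ = z≡y₂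
    ... | no z≢y₂ with w , y₀∼w , w≢y₁ ∷ w≢y₂ ∷ w≢z ∷ [] ← other-neighbour z =
      ⊥-elim (no-big-tail (path (∼-sym y₁∼y₂) y₁∼z (∼-sym y₀∼z) y₀∼w
                (≢-sym z≢y₂) (≢-sym y₀≢y₂) (≢-sym w≢y₂) (≢-sym y₀≢y₁) (≢-sym w≢y₁) (≢-sym w≢z)) big)

  -- In a large connected graph the big vertex near y₀ is y₂, so the Shape holds.
  shape : Connected H → 344 ≤ n → Shape
  shape conn large with v , v∈B₂ , big ← big-vertex-near conn large with refl ← big-is-y₂ v∈B₂ big =
    big-y₂-shape big

  -- A fifth neighbour of y₀ would make y₀ y₁ y₂ y₃ y₄ a roomy tail.
  degree-four : Shape → deg H y₀ ≡ 4
  degree-four S with deg H y₀ ≟ℕ 4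
  ... | yes deg≡4 = deg≡4
  ... | no deg≢4  =
    ⊥-elim (free (roomy-tail P (≤∧≢⇒< deg≥4 (≢-sym deg≢4)) (Shape.y₀≁y₃ S) (Shape.y₀≁y₄ S)))

  -- If N(y₀) ⊆ {y₁, y₂, u, w} and y₁ ∼ u, then u = y₂, so N(y₀) ⊆ {y₁, y₂, w}
  -- contradicts deg y₀ ≥ 4.
  y₁≁other-neighbour : Shape → ∀ u w → (∀ v → y₀ ∼ v → v ≡ y₁ ⊎ v ≡ y₂ ⊎ v ≡ u ⊎ v ≡ w) →
                       y₀ ∼ u → ¬ y₁ ∼ u
  y₁≁other-neighbour S u w N⊆ y₀∼u y₁∼u
    with refl ← Shape.only-common-neighbour S y₀∼u y₁∼u
    with z , y₀∼z , z≢y₁ ∷ z≢y₂ ∷ z≢w ∷ [] ← other-neighbour w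
    with N⊆ z y₀∼z
  ... | inj₁ z≡y₁               = z≢y₁ z≡y₁
  ... | inj₂ (inj₁ z≡y₂)        = z≢y₂ z≡y₂
  ... | inj₂ (inj₂ (inj₁ z≡y₂)) = z≢y₂ z≡y₂
  ... | inj₂ (inj₂ (inj₂ z≡w))  = z≢w z≡w

  y₁≁other-neighbours : Shape → ∀ y′ y″ → (∀ v → v ∼ y₀ ⇔ (v ≡ y₁ ⊎ v ≡ y₂ ⊎ v ≡ y′ ⊎ v ≡ y″)) →
                        ¬ y₁ ∼ y′ × ¬ y₁ ∼ y″
  y₁≁other-neighbours S y′ y″ N =
    y₁≁other-neighbour S y′ y″ (λ v y₀∼v → to (N v) (∼-sym y₀∼v))
      (∼-sym (from (N y′) (inj₂ (inj₂ (inj₁ refl))))) ,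
    y₁≁other-neighbour S y″ y′ (λ v y₀∼v → map₂ (map₂ swap) (to (N v) (∼-sym y₀∼v)))
      (∼-sym (from (N y″) (inj₂ (inj₂ (inj₂ refl)))))
    where open Equivalence

lemma3p3 : Σ ℕ λ n₀ → ∀ (n : ℕ) (H : Graph n) → n ≥ n₀ → Connected H → S44-free H →
    ∀ (y₀ y₁ y₂ y₃ y₄ : Fin n) → deg H y₀ ≥ 4 →
    y₀ ≢ y₁ → y₀ ≢ y₂ → y₀ ≢ y₃ → y₀ ≢ y₄ → y₁ ≢ y₂ → y₁ ≢ y₃ → y₁ ≢ y₄ →
    y₂ ≢ y₃ → y₂ ≢ y₄ → y₃ ≢ y₄ →
    y₀ ∼[ H ] y₁ → y₁ ∼[ H ] y₂ → y₂ ∼[ H ] y₃ → y₃ ∼[ H ] y₄ →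
    (deg H y₀ ≡ 4)
    × (y₀ ∼[ H ] y₂ × ¬ (y₀ ∼[ H ] y₃) × ¬ (y₀ ∼[ H ] y₄))
    × (∀ (y′ y″ : Fin n) →
    (∀ v → v ∼[ H ] y₀ ⇔ (v ≡ y₁ ⊎ v ≡ y₂ ⊎ v ≡ y′ ⊎ v ≡ y″)) →
    ¬ (y₁ ∼[ H ] y′) × ¬ (y₁ ∼[ H ] y″))
lemma3p3 = 344 , λ n H large conn free y₀ y₁ y₂ y₃ y₄ deg≥4
                   _ y₀≢y₂ y₀≢y₃ y₀≢y₄ _ y₁≢y₃ y₁≢y₄ _ y₂≢y₄ _ y₀∼y₁ y₁∼y₂ y₂∼y₃ y₃∼y₄ →
  let open AroundPath H free y₀ y₁ y₂ y₃ y₄ deg≥4 y₀≢y₂ y₀≢y₃ y₀≢y₄ y₁≢y₃ y₁≢y₄ y₂≢y₄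
                      y₀∼y₁ y₁∼y₂ y₂∼y₃ y₃∼y₄
      S = shape conn large
  in degree-four S
   , (Shape.y₀∼y₂ S , Shape.y₀≁y₃ S , Shape.y₀≁y₄ S)
   , y₁≁other-neighbours S
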